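{- Let $a,b\geq 2$ be integers and let $t_1\geq\cdots\geq t_a$ be positive even integers with $\sum_{i=1}^a t_i=2(a+b)$. Let $\mathbf{d}=(2a+b-1,1,\ldots,1)\in\mathbb{Z}_+^{b+2}$ (first entry $2a+b-1$, the other $b+1$ entries equal to $1$) and $\mathbf{t}=(t_1,\ldots,t_a)\in\mathbb{Z}_+^a$. Then the pair $(\mathbf{d};\mathbf{t})$ is not realizable, i.e., it is not the degree sequence of any geographic plan.
   Context: Graphs are finite and undirected, with loops and multiple edges allowed; a loop contributes $2$ to the degree of its vertex. A map is an embedding of a connected graph $G=(V,E)$ in a compact surface without boundary such that edges meet only at common endpoints and every connected component of the complement of the image (a country) is homeomorphic to an open disk. The dual graph $G^*$ has the countries as vertices and has the same edge set $E$: each edge $e$ joins the one or two countries on whose boundary it lies. A plan is a pair $(G,H)$ of graphs with a common edge set; it is geographic if there is a map of $G$ such that $H$ is its dual graph $G^*$ (with the given identification of edges). If $G$ has degree sequence $\mathbf{d}$ and $H$ has degree sequence $\mathbf{t}$ (up to ordering), then $(\mathbf{d};\mathbf{t})$ is the degree sequence of the plan. A pair $(\mathbf{d};\mathbf{t})$ is realizable if it is the degree sequence of some geographic plan. -}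

module Defs where

open import Data.Nat using (ℕ; suc; _+_; _*_; _∸_; _<_)
open import Data.Fin as Fin using (Fin)
open import Data.List using (List; length; filter; allFin)
open import Data.Vec using (Vec; lookup; _∷_; replicate)
open import Data.Product using (Σ; ∃; _×_; _,_)
open import Relation.Binary.PropositionalEquality using (_≡_; _≢_)

-- Combinatorial maps (flag / "gem" encoding of maps on arbitrary compact
-- surfaces without boundary, orientable or not).  Vertices = orbits of <r1,r2>,
-- edges = orbits of <r0,r2> (each of size 4), countries = orbits of <r0,r1>.
-- The degree of a vertex (resp. country) is half the number of flags in it;
-- loops count twice, an edge with the same country on both sides counts twice
-- for that country, exactly as in G and its dual G*.

data Gen : Set where
  g0 g1 g2 : Gen

data VertGen : Gen → Set where
  v1 : VertGen g1
  v2 : VertGen g2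

data FaceGen : Gen → Set where
  f0 : FaceGen g0
  f1 : FaceGen g1

data AnyGen : Gen → Set where
  any : ∀ g → AnyGen g

data Reach {A : Set} (allowed : Gen → Set) (r : Gen → A → A) : A → A → Set where
  here : ∀ {x} → Reach allowed r x x
  step : ∀ {x y} g → allowed g → Reach allowed r (r g x) y → Reach allowed r x y

record CombMap : Set where
  field
    nFlags    : ℕ
    r         : Gen → Fin nFlags → Fin nFlags
    invol     : ∀ g x → r g (r g x) ≡ x
    fpf       : ∀ g x → r g x ≢ x
    comm02    : ∀ x → r g0 (r g2 x) ≡ r g2 (r g0 x)
    fpf02     : ∀ x → r g0 (r g2 x) ≢ x
    connected : ∀ x y → Reach AnyGen r x y

flagCount : ∀ {n m} → (Fin n → Fin m) → Fin m → ℕ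
flagCount {n} lab i = length (filter (λ x → lab x Fin.≟ i) (allFin n))

record Realization {p q : ℕ} (d : Vec ℕ p) (t : Vec ℕ q) : Set where
  field
    M : CombMap
  open CombMap M
  field
    vert       : Fin nFlags → Fin p
    face       : Fin nFlags → Fin q
    vert-sound : ∀ x y → vert x ≡ vert y → Reach VertGen r x y
    vert-compl : ∀ x y → Reach VertGen r x y → vert x ≡ vert y
    face-sound : ∀ x y → face x ≡ face y → Reach FaceGen r x y
    face-compl : ∀ x y → Reach FaceGen r x y → face x ≡ face y
    vert-surj  : ∀ i → ∃ λ x → vert x ≡ i
    face-surj  : ∀ j → ∃ λ x → face x ≡ j
    vert-deg   : ∀ i → flagCount vert i ≡ 2 * lookup d i
    face-deg   : ∀ j → flagCount face j ≡ 2 * lookup t j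

Realizable : ∀ {p q} → Vec ℕ p → Vec ℕ q → Set
Realizable d t = Realization d t

dSeq : (a b : ℕ) → Vec ℕ (suc (suc b))
dSeq a b = (2 * a + b ∸ 1) ∷ replicate (suc b) 1

-- There are 4(a + b) flags, four per edge.  Call a flag inner if both sides of
-- its edge lie in the same country, separating otherwise.  In each country the
-- inner flags form free orbits of the Klein four-group ⟨r₀, r₂⟩ and the country
-- has 2tᵢ ≡ 0 (mod 4) flags, so its separating flags are a multiple of 4; some
-- exist because a ≥ 2 and the map is connected, so there are at least 4a
-- separating flags.  At each of the b + 1 leaves r₁ = r₂, so pendant edges are
-- inner; no edge joins two leaves (the map would be a single edge), so they
-- contribute 4(b + 1) inner flags, and 4a + 4(b + 1) > 4(a + b).
module Submission where

open import Defs
open import Data.Nat using (ℕ; _+_; _*_; _≤_; _<_)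
open import Data.Fin as Fin using (Fin)
open import Data.Vec using (Vec; lookup; sum)
open import Data.Product using (∃)
open import Relation.Binary.PropositionalEquality using (_≡_)
open import Relation.Nullary using (¬_)

open import Data.Nat.Properties
  using (+-*-semiring; ≤-refl; ≤-reflexive; ≤-trans; <⇒≱; m≤m+n; m+1+n≰m; m∸n+n≡m;
         +-identityʳ; +-mono-≤; +-monoˡ-≤; *-monoʳ-≤; *-assoc; *-comm; module ≤-Reasoning)
open import Algebra.Properties.Semiring.Sum +-*-semiring
  using (sum-syntax; sum-cong-≗; ∑-distrib-+; ∑-comm; sum-permute; *-distribˡ-sum)
open import Data.Bool using (Bool; true; false; not; _∧_; _xor_)
open import Data.Bool.Properties using (¬-not)
open import Data.Empty using (⊥-elim)
open import Data.Fin using (zero; suc; _≟_; _<?_; punchIn)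
open import Data.Fin.Patterns using (0F; 1F; 2F; 3F)
open import Data.Fin.Permutation using (permutation)
import Data.Fin.Properties as Finₚ
open import Data.List using (length; filter; tabulate)
open import Data.Nat using (zero; suc; _∸_; z≤n; s≤s; NonZero)
open import Data.Nat.Divisibility using (_∣_; divides; ∣⇒≤; ∣m+n∣m⇒∣n)
open import Data.Nat.Tactic.RingSolver using (solve-∀)
open import Data.Product using (_×_; _,_; proj₁; proj₂)
open import Data.Vec using (_∷_; [])
open import Data.Vec.Properties using (lookup-replicate)
open import Function using (_∘_)
open import Level using (0ℓ)
open import Relation.Binary using (tri<; tri≈; tri>)
open import Relation.Binary.PropositionalEquality
  using (_≢_; _≗_; refl; sym; trans; cong; cong₂; subst; module ≡-Reasoning)
open import Relation.Nullary using (does; yes; no; contradiction)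
open import Relation.Nullary.Decidable using (dec-true; dec-false)
open import Relation.Unary using (Pred; Decidable)

indicator : Bool → ℕ
indicator false = 0
indicator true  = 1

count : ∀ {n} → (Fin n → Bool) → ℕ
count {n} p = ∑[ x < n ] indicator (p x)

count-cong : ∀ {n} {p q : Fin n → Bool} → p ≗ q → count p ≡ count q
count-cong p≗q = sum-cong-≗ (cong indicator ∘ p≗q)

count-true : ∀ n → count {n} (λ _ → true) ≡ n
count-true zero    = refl
count-true (suc n) = cong suc (count-true n)

count-false : ∀ n → count {n} (λ _ → false) ≡ 0
count-false zero    = refl
count-false (suc n) = count-false n

count-split : ∀ {n} (p q : Fin n → Bool) →
  count p ≡ count (λ x → q x ∧ p x) + count (λ x → not (q x) ∧ p x)
count-split p q = trans (sum-cong-≗ (λ x → indicator-split (p x) (q x)))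
  (∑-distrib-+ (λ x → indicator (q x ∧ p x)) (λ x → indicator (not (q x) ∧ p x)))
  where
  indicator-split : ∀ a b → indicator a ≡ indicator (b ∧ a) + indicator (not b ∧ a)
  indicator-split false false = refl
  indicator-split false true  = refl
  indicator-split true  false = refl
  indicator-split true  true  = refl

count+count-not : ∀ {n} (p : Fin n → Bool) → count p + count (not ∘ p) ≡ n
count+count-not {n} p =
  trans (sym (∑-distrib-+ (indicator ∘ p) (indicator ∘ not ∘ p)))
        (trans (sum-cong-≗ (indicator-complement ∘ p)) (count-true n))
  where
  indicator-complement : ∀ a → indicator a + indicator (not a) ≡ 1
  indicator-complement false = refl
  indicator-complement true  = refl

count-mono : ∀ {n} {p q : Fin n → Bool} → (∀ x → p x ≡ true → q x ≡ true) → count p ≤ count q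
count-mono {zero}          p⇒q = z≤n
count-mono {suc n} {p} {q} p⇒q =
  +-mono-≤ (indicator-mono (p zero) (q zero) (p⇒q zero)) (count-mono (p⇒q ∘ suc))
  where
  indicator-mono : ∀ a b → (a ≡ true → b ≡ true) → indicator a ≤ indicator b
  indicator-mono false b     a⇒b = z≤n
  indicator-mono true  false a⇒b = contradiction (a⇒b refl) λ ()
  indicator-mono true  true  a⇒b = ≤-refl

count-∘-involution : ∀ {n} (p : Fin n → Bool) {σ : Fin n → Fin n} →
  (∀ x → σ (σ x) ≡ x) → count (p ∘ σ) ≡ count p
count-∘-involution p {σ} σ-invol =
  sym (sum-permute (indicator ∘ p) (permutation σ σ σ-invol σ-invol))

count-≟ : ∀ {n} (c : Fin n) → count (λ j → does (c ≟ j)) ≡ 1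
count-≟ {suc n} zero    = cong suc (count-false n)
count-≟ {suc n} (suc c) = count-≟ c

∑-count-fibres : ∀ {m n} (p : Fin m → Bool) (f : Fin m → Fin n) →
  ∑[ j < n ] count (λ x → p x ∧ does (f x ≟ j)) ≡ count p
∑-count-fibres {n = n} p f =
  trans (sym (∑-comm (λ x j → indicator (p x ∧ does (f x ≟ j)))))
        (sum-cong-≗ (λ x → indicator-fibre (p x) (f x)))
  where
  indicator-fibre : ∀ b c → ∑[ j < n ] indicator (b ∧ does (c ≟ j)) ≡ indicator b
  indicator-fibre false c = count-false n
  indicator-fibre true  c = count-≟ c

n*k≤∑ : ∀ {n k} (f : Fin n → ℕ) → (∀ i → k ≤ f i) → n * k ≤ ∑[ i < n ] f i
n*k≤∑ {zero}  f k≤f = z≤n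
n*k≤∑ {suc n} f k≤f = +-mono-≤ (k≤f zero) (n*k≤∑ (f ∘ suc) (k≤f ∘ suc))

infixl 6 _∖_

_∖_ : ∀ {n} → (Fin n → Bool) → Fin n → Fin n → Bool
(p ∖ x) y = not (does (x ≟ y)) ∧ p y

∖-true : ∀ {n} (p : Fin n → Bool) {x y} → p y ≡ true → x ≢ y → (p ∖ x) y ≡ true
∖-true p {x} {y} py x≢y = cong₂ (λ a b → not a ∧ b) (dec-false (x ≟ y) x≢y) py

count-remove : ∀ {n} (p : Fin n → Bool) {x} → p x ≡ true → count p ≡ suc (count (p ∖ x))
count-remove p {x} px =
  trans (count-split p (λ y → does (x ≟ y)))
        (cong (_+ count (p ∖ x)) (trans (count-cong at-x) (count-≟ x)))
  where
  at-x : ∀ y → (does (x ≟ y) ∧ p y) ≡ does (x ≟ y)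
  at-x y with x ≟ y
  ... | yes refl = px
  ... | no  _    = refl

count-nonZero : ∀ {n} (p : Fin n → Bool) {x} → p x ≡ true → NonZero (count p)
count-nonZero p px rewrite count-remove p px = _

3≤count : ∀ {n} (p : Fin n → Bool) {x y z} → p x ≡ true → p y ≡ true → p z ≡ true →
  x ≢ y → x ≢ z → y ≢ z → 3 ≤ count p
3≤count p {x} {y} {z} px py pz x≢y x≢z y≢z = subst (3 ≤_) (sym removed) (m≤m+n 3 _)
  where
  open ≡-Reasoning
  removed : count p ≡ 3 + count (p ∖ x ∖ y ∖ z)
  removed = begin
    count p                    ≡⟨ count-remove p px ⟩
    1 + count (p ∖ x)          ≡⟨ cong suc (count-remove (p ∖ x) (∖-true p py x≢y)) ⟩
    2 + count (p ∖ x ∖ y)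
      ≡⟨ cong (2 +_) (count-remove (p ∖ x ∖ y) (∖-true (p ∖ x) (∖-true p pz x≢z) y≢z)) ⟩
    3 + count (p ∖ x ∖ y ∖ z)  ∎

module FreeInvolution {n} (σ : Fin n → Fin n)
  (σ-invol : ∀ x → σ (σ x) ≡ x) (σ-fpf : ∀ x → σ x ≢ x) where

  below : Fin n → Bool
  below x = does (x <? σ x)

  below-σ : ∀ x → below (σ x) ≡ not (below x)
  below-σ x rewrite σ-invol x with Finₚ.<-cmp x (σ x)
  ... | tri< x<σx _ _ rewrite dec-true (x <? σ x) x<σx = dec-false (σ x <? x) (Finₚ.<-asym x<σx)
  ... | tri≈ _ x≡σx _ = ⊥-elim (σ-fpf x (sym x≡σx))
  ... | tri> _ _ σx<x rewrite dec-false (x <? σ x) (Finₚ.<-asym σx<x) = dec-true (σ x <? x) σx<x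

  count≡2*count-below : (p : Fin n → Bool) → (∀ x → p (σ x) ≡ p x) →
    count p ≡ 2 * count (λ x → below x ∧ p x)
  count≡2*count-below p p-σ = begin
    count p                       ≡⟨ count-split p below ⟩
    count q + count (λ x → not (below x) ∧ p x)
      ≡⟨ cong (count q +_) (count-cong λ x → sym (cong₂ _∧_ (below-σ x) (p-σ x))) ⟩
    count q + count (q ∘ σ)       ≡⟨ cong (count q +_) (count-∘-involution q σ-invol) ⟩
    count q + count q             ≡⟨ cong (count q +_) (sym (+-identityʳ _)) ⟩
    2 * count q                   ∎
    where
    open ≡-Reasoning
    q = λ x → below x ∧ p x

2*[2*n]≡n*4 : ∀ n → 2 * (2 * n) ≡ n * 4
2*[2*n]≡n*4 n = trans (sym (*-assoc 2 2 n)) (*-comm 4 n)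

xor-cancelʳ : ∀ a b → (a xor b) xor b ≡ a
xor-cancelʳ false false = refl
xor-cancelʳ false true  = refl
xor-cancelʳ true  false = refl
xor-cancelʳ true  true  = refl

xor-cancelˡ : ∀ a b → (a xor b) xor a ≡ b
xor-cancelˡ false false = refl
xor-cancelˡ false true  = refl
xor-cancelˡ true  false = refl
xor-cancelˡ true  true  = refl

module KleinFour {n} (σ τ : Fin n → Fin n)
  (σ-invol : ∀ x → σ (σ x) ≡ x) (τ-invol : ∀ x → τ (τ x) ≡ x)
  (σ-fpf : ∀ x → σ x ≢ x) (τ-fpf : ∀ x → τ x ≢ x) (στ-fpf : ∀ x → σ (τ x) ≢ x)
  (σ∘τ≗τ∘σ : ∀ x → σ (τ x) ≡ τ (σ x)) where

  open FreeInvolution σ σ-invol σ-fpf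

  σ^ : Bool → Fin n → Fin n
  σ^ false x = x
  σ^ true  x = σ x

  -- ρ x is the point of the σ-orbit {τ x, σ (τ x)} with the same `below` as x:
  -- a free involution preserving `below`, so halving by σ can be followed by
  -- halving by ρ.
  ρ : Fin n → Fin n
  ρ x = σ^ (below x xor below (τ x)) (τ x)

  σ^-invol : ∀ b x → σ^ b (σ^ b x) ≡ x
  σ^-invol false x = refl
  σ^-invol true  x = σ-invol x

  τ∘σ^ : ∀ b x → τ (σ^ b x) ≡ σ^ b (τ x)
  τ∘σ^ false x = refl
  τ∘σ^ true  x = sym (σ∘τ≗τ∘σ x)

  below-σ^ : ∀ b x → below (σ^ b x) ≡ b xor below x
  below-σ^ false x = refl
  below-σ^ true  x = below-σ x

  ρ-below : ∀ x → below (ρ x) ≡ below x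
  ρ-below x =
    trans (below-σ^ (below x xor below (τ x)) (τ x)) (xor-cancelʳ (below x) (below (τ x)))

  ρ-invol : ∀ x → ρ (ρ x) ≡ x
  ρ-invol x = trans (cong₂ σ^ same-switch τρx≡σ^x) (σ^-invol c x)
    where
    c = below x xor below (τ x)
    τρx≡σ^x : τ (ρ x) ≡ σ^ c x
    τρx≡σ^x = trans (τ∘σ^ c (τ x)) (cong (σ^ c) (τ-invol x))
    same-switch : below (ρ x) xor below (τ (ρ x)) ≡ c
    same-switch = cong₂ _xor_ (ρ-below x)
      (trans (cong below τρx≡σ^x) (trans (below-σ^ c x) (xor-cancelˡ (below x) (below (τ x)))))

  ρ-fpf : ∀ x → ρ x ≢ x
  ρ-fpf x = σ^∘τ-fpf (below x xor below (τ x))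
    where
    σ^∘τ-fpf : ∀ b → σ^ b (τ x) ≢ x
    σ^∘τ-fpf false = τ-fpf x
    σ^∘τ-fpf true  = στ-fpf x

  ρ-invariant : (p : Fin n → Bool) → (∀ x → p (σ x) ≡ p x) → (∀ x → p (τ x) ≡ p x) →
    ∀ x → p (ρ x) ≡ p x
  ρ-invariant p p-σ p-τ x = trans (σ^-invariant (below x xor below (τ x))) (p-τ x)
    where
    σ^-invariant : ∀ b → p (σ^ b (τ x)) ≡ p (τ x)
    σ^-invariant false = refl
    σ^-invariant true  = p-σ (τ x)

  4∣count : (p : Fin n → Bool) → (∀ x → p (σ x) ≡ p x) → (∀ x → p (τ x) ≡ p x) → 4 ∣ count p
  4∣count p p-σ p-τ = divides (count r) (begin
    count p            ≡⟨ count≡2*count-below p p-σ ⟩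
    2 * count q        ≡⟨ cong (2 *_) (Ρ.count≡2*count-below q q-ρ) ⟩
    2 * (2 * count r)  ≡⟨ 2*[2*n]≡n*4 (count r) ⟩
    count r * 4        ∎)
    where
    open ≡-Reasoning
    module Ρ = FreeInvolution ρ ρ-invol ρ-fpf
    q r : Fin n → Bool
    q x = below x ∧ p x
    r x = Ρ.below x ∧ q x
    q-ρ : ∀ x → q (ρ x) ≡ q x
    q-ρ x = cong₂ _∧_ (ρ-below x) (ρ-invariant p p-σ p-τ x)

flagCount≡count : ∀ {n m} (lab : Fin n → Fin m) (i : Fin m) →
  flagCount lab i ≡ count (λ x → does (lab x ≟ i))
flagCount≡count lab i = length-filter-tabulate (λ x → lab x ≟ i) (λ x → x)
  where
  length-filter-tabulate : ∀ {A : Set} {P : Pred A 0ℓ} (P? : Decidable P) {n} (g : Fin n → A) →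
    length (filter P? (tabulate g)) ≡ count (λ x → does (P? (g x)))
  length-filter-tabulate P? {zero}  g = refl
  length-filter-tabulate P? {suc n} g with does (P? (g zero))
  ... | true  = cong suc (length-filter-tabulate P? (g ∘ suc))
  ... | false = length-filter-tabulate P? (g ∘ suc)

∑-lookup : ∀ {n} (t : Vec ℕ n) → ∑[ i < n ] lookup t i ≡ sum t
∑-lookup []      = refl
∑-lookup (x ∷ t) = cong (x +_) (∑-lookup t)

another : ∀ {n} → 2 ≤ n → (j : Fin n) → ∃ λ j' → j' ≢ j
another (s≤s (s≤s _)) j = punchIn j zero , Finₚ.punchInᵢ≢i j zero

image-Reach-closed : ∀ {A : Set} {allowed : Gen → Set} {r : Gen → A → A} {k}
  (s : Fin k → A) (τ : Gen → Fin k → Fin k) → (∀ g i → r g (s i) ≡ s (τ g i)) →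
  ∀ {x y} → Reach allowed r x y → ∀ i → s i ≡ x → ∃ λ j → s j ≡ y
image-Reach-closed s τ s-equivariant here i si≡x = i , si≡x
image-Reach-closed {r = r} s τ s-equivariant (step g _ path) i si≡x =
  image-Reach-closed s τ s-equivariant path (τ g i) (trans (sym (s-equivariant g i)) (cong (r g) si≡x))

surjective⇒≤ : ∀ {m n} (s : Fin m → Fin n) → (∀ y → ∃ λ i → s i ≡ y) → n ≤ m
surjective⇒≤ s s-surjective = Finₚ.injective⇒≤ {f = proj₁ ∘ s-surjective} section-injective
  where
  section-injective : ∀ {y y'} → proj₁ (s-surjective y) ≡ proj₁ (s-surjective y') → y ≡ y'
  section-injective {y} {y'} e =
    trans (sym (proj₂ (s-surjective y))) (trans (cong s e) (proj₂ (s-surjective y')))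

module CombMapProperties (M : CombMap) where
  open CombMap M

  pendant-at-both-ends⇒nFlags≤4 : ∀ x →
    r g1 x ≡ r g2 x → r g1 (r g0 x) ≡ r g2 (r g0 x) → nFlags ≤ 4
  pendant-at-both-ends⇒nFlags≤4 x x-pendant r0x-pendant =
    surjective⇒≤ s (λ y → image-Reach-closed s τ s-equivariant (connected x y) 0F refl)
    where
    s : Fin 4 → Fin nFlags
    s 0F = x
    s 1F = r g1 x
    s 2F = r g0 x
    s 3F = r g0 (r g1 x)

    τ : Gen → Fin 4 → Fin 4
    τ g0 0F = 2F
    τ g0 1F = 3F
    τ g0 2F = 0F
    τ g0 3F = 1F
    τ _  0F = 1F
    τ _  1F = 0F
    τ _  2F = 3F
    τ _  3F = 2F

    r1r0x≡r0r1x : r g1 (r g0 x) ≡ r g0 (r g1 x)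
    r1r0x≡r0r1x = trans r0x-pendant (trans (sym (comm02 x)) (cong (r g0) (sym x-pendant)))

    s-equivariant : ∀ g i → r g (s i) ≡ s (τ g i)
    s-equivariant g0 0F = refl
    s-equivariant g0 1F = refl
    s-equivariant g0 2F = invol g0 x
    s-equivariant g0 3F = invol g0 (r g1 x)
    s-equivariant g1 0F = refl
    s-equivariant g1 1F = invol g1 x
    s-equivariant g1 2F = r1r0x≡r0r1x
    s-equivariant g1 3F = trans (cong (r g1) (sym r1r0x≡r0r1x)) (invol g1 (r g0 x))
    s-equivariant g2 0F = sym x-pendant
    s-equivariant g2 1F = trans (cong (r g2) x-pendant) (invol g2 x)
    s-equivariant g2 2F = trans (sym r0x-pendant) r1r0x≡r0r1x
    s-equivariant g2 3F =
      trans (cong (r g2) (trans (sym r1r0x≡r0r1x) r0x-pendant)) (invol g2 (r g0 x))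

module RealizationProperties {p q} {d : Vec ℕ p} {t : Vec ℕ q} (R : Realization d t) where
  open Realization R
  open CombMap M
  open CombMapProperties M

  face-r0 : ∀ x → face (r g0 x) ≡ face x
  face-r0 x = sym (face-compl x (r g0 x) (step g0 f0 here))

  face-r1 : ∀ x → face (r g1 x) ≡ face x
  face-r1 x = sym (face-compl x (r g1 x) (step g1 f1 here))

  vert-r1 : ∀ x → vert (r g1 x) ≡ vert x
  vert-r1 x = sym (vert-compl x (r g1 x) (step g1 v1 here))

  vert-r2 : ∀ x → vert (r g2 x) ≡ vert x
  vert-r2 x = sym (vert-compl x (r g2 x) (step g2 v2 here))

  flags-in-face : ∀ j → count (λ x → does (face x ≟ j)) ≡ 2 * lookup t j
  flags-in-face j = trans (sym (flagCount≡count face j)) (face-deg j)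

  flags-at-vertex : ∀ i → count (λ x → does (vert x ≟ i)) ≡ 2 * lookup d i
  flags-at-vertex i = trans (sym (flagCount≡count vert i)) (vert-deg i)

  nFlags≡2*sum : nFlags ≡ 2 * sum t
  nFlags≡2*sum = begin
    nFlags                                       ≡⟨ sym (count-true nFlags) ⟩
    count {nFlags} (λ _ → true)                  ≡⟨ sym (∑-count-fibres (λ _ → true) face) ⟩
    ∑[ j < q ] count (λ x → does (face x ≟ j))   ≡⟨ sum-cong-≗ flags-in-face ⟩
    ∑[ j < q ] (2 * lookup t j)                  ≡⟨ sym (*-distribˡ-sum 2 (lookup t)) ⟩
    2 * (∑[ j < q ] lookup t j)                  ≡⟨ cong (2 *_) (∑-lookup t) ⟩
    2 * sum t                                    ∎
    where open ≡-Reasoning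

  -- r₂ x is the flag across the edge of x.
  inner : Fin nFlags → Bool
  inner x = does (face (r g2 x) ≟ face x)

  inner-r0 : ∀ x → inner (r g0 x) ≡ inner x
  inner-r0 x = cong₂ (λ u v → does (u ≟ v))
    (trans (cong face (sym (comm02 x))) (face-r0 (r g2 x))) (face-r0 x)

  inner-in-face-r2 : ∀ j x →
    (inner (r g2 x) ∧ does (face (r g2 x) ≟ j)) ≡ (inner x ∧ does (face x ≟ j))
  inner-in-face-r2 j x =
    trans (cong (λ y → does (face y ≟ face (r g2 x)) ∧ does (face (r g2 x) ≟ j)) (invol g2 x))
          (≟-swap (face x) (face (r g2 x)))
    where
    ≟-swap : ∀ u v → (does (u ≟ v) ∧ does (v ≟ j)) ≡ (does (v ≟ u) ∧ does (u ≟ j))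
    ≟-swap u v with u ≟ v | v ≟ u
    ... | yes refl | yes _    = refl
    ... | yes refl | no  u≢u  = contradiction refl u≢u
    ... | no  u≢v  | yes refl = contradiction refl u≢v
    ... | no  _    | no  _    = refl

  4∣count-separating-in-face : ∀ j → (∃ λ k → lookup t j ≡ 2 * k) →
    4 ∣ count (λ x → not (inner x) ∧ does (face x ≟ j))
  4∣count-separating-in-face j (k , tj≡2k) = ∣m+n∣m⇒∣n 4∣flags-in-face 4∣inner-in-face
    where
    open ≡-Reasoning
    open KleinFour (r g0) (r g2) (invol g0) (invol g2) (fpf g0) (fpf g2) fpf02 comm02
      using (4∣count)
    in-j : Fin nFlags → Bool
    in-j x = does (face x ≟ j)
    4∣flags-in-face : 4 ∣ count (λ x → inner x ∧ in-j x) + count (λ x → not (inner x) ∧ in-j x)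
    4∣flags-in-face = divides k (begin
      count (λ x → inner x ∧ in-j x) + count (λ x → not (inner x) ∧ in-j x)
                       ≡⟨ sym (count-split in-j inner) ⟩
      count in-j       ≡⟨ flags-in-face j ⟩
      2 * lookup t j   ≡⟨ cong (2 *_) tj≡2k ⟩
      2 * (2 * k)      ≡⟨ 2*[2*n]≡n*4 k ⟩
      k * 4            ∎)
    4∣inner-in-face : 4 ∣ count (λ x → inner x ∧ in-j x)
    4∣inner-in-face = 4∣count (λ x → inner x ∧ in-j x)
      (λ x → cong₂ (λ b f → b ∧ does (f ≟ j)) (inner-r0 x) (face-r0 x)) (inner-in-face-r2 j)

  separating-flag-in-face : ∀ {j j'} → j' ≢ j → ∃ λ x → face x ≡ j × face (r g2 x) ≢ j
  separating-flag-in-face {j} {j'} j'≢j with face-surj j | face-surj j'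
  ... | x , fx≡j | y , fy≡j' =
    leave (connected x y) fx≡j (λ fy≡j → j'≢j (trans (sym fy≡j') fy≡j))
    where
    leave : ∀ {x y} → Reach AnyGen r x y → face x ≡ j → face y ≢ j →
      ∃ λ z → face z ≡ j × face (r g2 z) ≢ j
    leave here fx≡j fy≢j = contradiction fx≡j fy≢j
    leave (step g0 _ path) fx≡j fy≢j = leave path (trans (face-r0 _) fx≡j) fy≢j
    leave (step g1 _ path) fx≡j fy≢j = leave path (trans (face-r1 _) fx≡j) fy≢j
    leave {x} (step g2 _ path) fx≡j fy≢j with face (r g2 x) ≟ j
    ... | yes fr2x≡j = leave path fr2x≡j fy≢j
    ... | no  fr2x≢j = x , fx≡j , fr2x≢j

  4≤count-separating-in-face : ∀ {j j'} → j' ≢ j → (∃ λ k → lookup t j ≡ 2 * k) →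
    4 ≤ count (λ x → not (inner x) ∧ does (face x ≟ j))
  4≤count-separating-in-face {j} j'≢j tj-even with separating-flag-in-face j'≢j
  ... | x , fx≡j , fr2x≢j =
    ∣⇒≤ ⦃ count-nonZero separating-in-j x-separating ⦄ (4∣count-separating-in-face j tj-even)
    where
    separating-in-j : Fin nFlags → Bool
    separating-in-j x = not (inner x) ∧ does (face x ≟ j)
    x-separating : separating-in-j x ≡ true
    x-separating = cong₂ (λ a b → not a ∧ b)
      (dec-false (face (r g2 x) ≟ face x) (λ e → fr2x≢j (trans e fx≡j)))
      (dec-true (face x ≟ j) fx≡j)

  q*4≤count-separating : (∀ j → ∃ λ j' → j' ≢ j) → (∀ j → ∃ λ k → lookup t j ≡ 2 * k) →
    q * 4 ≤ count (not ∘ inner)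
  q*4≤count-separating other t-even = begin
    q * 4
      ≤⟨ n*k≤∑ _ (λ j → 4≤count-separating-in-face (proj₂ (other j)) (t-even j)) ⟩
    ∑[ j < q ] count (λ x → not (inner x) ∧ does (face x ≟ j))
      ≡⟨ ∑-count-fibres (not ∘ inner) face ⟩
    count (not ∘ inner) ∎
    where open ≤-Reasoning

  r1≡r2⇒inner : ∀ {x} → r g1 x ≡ r g2 x → inner x ≡ true
  r1≡r2⇒inner {x} r1x≡r2x =
    dec-true (face (r g2 x) ≟ face x) (trans (cong face (sym r1x≡r2x)) (face-r1 x))

  degree-one⇒r1≡r2 : ∀ x → lookup d (vert x) ≡ 1 → r g1 x ≡ r g2 x
  degree-one⇒r1≡r2 x deg≡1 with r g1 x ≟ r g2 x
  ... | yes r1x≡r2x = r1x≡r2x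
  ... | no  r1x≢r2x = contradiction (subst (3 ≤_) two-flags three-flags) λ { (s≤s (s≤s ())) }
    where
    at-x : Fin nFlags → Bool
    at-x y = does (vert y ≟ vert x)
    two-flags : count at-x ≡ 2
    two-flags = trans (flags-at-vertex (vert x)) (cong (2 *_) deg≡1)
    three-flags : 3 ≤ count at-x
    three-flags = 3≤count at-x
      (dec-true (vert x ≟ vert x) refl)
      (dec-true (vert (r g1 x) ≟ vert x) (vert-r1 x))
      (dec-true (vert (r g2 x) ≟ vert x) (vert-r2 x))
      (fpf g1 x ∘ sym) (fpf g2 x ∘ sym) r1x≢r2x

  2*count-pendant≤count-inner : (L : Fin nFlags → Bool) →
    (∀ x → L x ≡ true → r g1 x ≡ r g2 x) → 4 < nFlags → 2 * count L ≤ count inner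
  2*count-pendant≤count-inner L L-pendant 4<nFlags = begin
    2 * count L                 ≡⟨ cong (count L +_) (+-identityʳ _) ⟩
    count L + count L           ≡⟨ cong (count L +_) (sym (count-∘-involution L (invol g0))) ⟩
    count L + count (L ∘ r g0)  ≤⟨ +-mono-≤ (count-mono L⇒) (count-mono L∘r0⇒) ⟩
    count (λ x → L x ∧ inner x) + count (λ x → not (L x) ∧ inner x)
                                ≡⟨ sym (count-split inner L) ⟩
    count inner                 ∎
    where
    open ≤-Reasoning
    L⇒ : ∀ x → L x ≡ true → (L x ∧ inner x) ≡ true
    L⇒ x Lx = cong₂ _∧_ Lx (r1≡r2⇒inner (L-pendant x Lx))
    L∘r0⇒ : ∀ x → L (r g0 x) ≡ true → (not (L x) ∧ inner x) ≡ true
    L∘r0⇒ x Lr0x = cong₂ _∧_ (cong not (¬-not x-not-pendant))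
      (trans (sym (inner-r0 x)) (r1≡r2⇒inner (L-pendant (r g0 x) Lr0x)))
      where
      x-not-pendant : L x ≢ true
      x-not-pendant Lx = <⇒≱ 4<nFlags
        (pendant-at-both-ends⇒nFlags≤4 x (L-pendant x Lx) (L-pendant (r g0 x) Lr0x))

flag-budget-exceeded : ∀ {a b L N} → 1 ≤ a → N ≡ 2 * (2 * (a + b)) →
  2 * (2 * a + b ∸ 1) + L ≡ N → ¬ (2 * L + a * 4 ≤ N)
flag-budget-exceeded {a} {b} {L} {N} (s≤s _) N≡ vertex-flags bound = m+1+n≰m (N + N) (begin
  N + N + 4                            ≡⟨ cong (λ n → n + n + 4) (sym vertex-flags) ⟩
  (2 * V + L) + (2 * V + L) + 4        ≡⟨ regroup₁ V L ⟩
  4 * (V + 1) + 2 * L                  ≡⟨ cong (λ v → 4 * v + 2 * L) V+1≡2a+b ⟩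
  4 * (2 * a + b) + 2 * L              ≡⟨ regroup₂ a b L ⟩
  (2 * L + a * 4) + 2 * (2 * (a + b))  ≡⟨ cong (2 * L + a * 4 +_) (sym N≡) ⟩
  (2 * L + a * 4) + N                  ≤⟨ +-monoˡ-≤ N bound ⟩
  N + N                                ∎)
  where
  open ≤-Reasoning
  V = 2 * a + b ∸ 1
  V+1≡2a+b : V + 1 ≡ 2 * a + b
  V+1≡2a+b = m∸n+n≡m (s≤s z≤n)
  regroup₁ : ∀ V L → (2 * V + L) + (2 * V + L) + 4 ≡ 4 * (V + 1) + 2 * L
  regroup₁ = solve-∀
  regroup₂ : ∀ a b L → 4 * (2 * a + b) + 2 * L ≡ (2 * L + a * 4) + 2 * (2 * (a + b))
  regroup₂ = solve-∀

proposition6p3 : (a b : ℕ) → 2 ≤ a → 2 ≤ b → (t : Vec ℕ a) →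
    (∀ i j → i Fin.≤ j → lookup t j ≤ lookup t i) →
    (∀ i → 0 < lookup t i) →
    (∀ i → ∃ λ k → lookup t i ≡ 2 * k) →
    sum t ≡ 2 * (a + b) →
    ¬ Realizable (dSeq a b) t
proposition6p3 a b 2≤a _ t _ _ t-even Σt≡2[a+b] R =
  flag-budget-exceeded (≤-trans (s≤s z≤n) 2≤a) nFlags≡4[a+b] vertex-flags
    (≤-trans (+-mono-≤ (2*count-pendant≤count-inner leaf leaf-pendant 4<nFlags)
                       (q*4≤count-separating (another 2≤a) t-even))
             (≤-reflexive (count+count-not inner)))
  where
  open Realization R
  open CombMap M
  open RealizationProperties R

  leaf : Fin nFlags → Bool
  leaf x = not (does (vert x ≟ zero))

  leaf-degree : ∀ i → not (does (i ≟ zero)) ≡ true → lookup (dSeq a b) i ≡ 1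
  leaf-degree zero    ()
  leaf-degree (suc i) _ = lookup-replicate i 1

  leaf-pendant : ∀ x → leaf x ≡ true → r g1 x ≡ r g2 x
  leaf-pendant x leaf-x = degree-one⇒r1≡r2 x (leaf-degree (vert x) leaf-x)

  nFlags≡4[a+b] : nFlags ≡ 2 * (2 * (a + b))
  nFlags≡4[a+b] = trans nFlags≡2*sum (cong (2 *_) Σt≡2[a+b])

  4<nFlags : 4 < nFlags
  4<nFlags = subst (4 <_) (sym nFlags≡4[a+b])
    (≤-trans (m≤m+n 5 3) (*-monoʳ-≤ 2 (*-monoʳ-≤ 2 (≤-trans 2≤a (m≤m+n a b)))))

  vertex-flags : 2 * (2 * a + b ∸ 1) + count leaf ≡ nFlags
  vertex-flags = trans (cong (_+ count leaf) (sym (flags-at-vertex zero)))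
                       (count+count-not (λ x → does (vert x ≟ zero)))
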